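{- Let $M$ be a $3$-connected matroid with a $3$-connected minor $N$ where $|E(N)|\ge 4$. If $T$ is an $N$-grounded triangle of $M$ and $x\in T$, then $M/x$ does not have an $N$-minor.
   Context: "Has an $N$-minor" means has a minor isomorphic to $N$. A triangle $T$ is $N$-grounded if for all distinct $a,b\in T$ none of $M/a/b$, $M/a\backslash b$, $M\backslash a/b$, $M\backslash a\backslash b$ has an $N$-minor. -}

module Defs where

open import Data.Nat using (ℕ; _+_; _∸_; _≤_; _<_)
open import Data.Fin using (Fin)
open import Data.Fin.Subset using (Subset; _∈_; _⊆_; _⊂_; _∩_; _∪_; _─_; ⁅_⁆; ∣_∣; Empty)
open import Data.Vec using (tabulate; lookup)
open import Data.Product using (Σ; ∃; ∃-syntax; _×_)
open import Relation.Nullary using (¬_)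
open import Relation.Binary.PropositionalEquality using (_≡_; _≢_)

-- A (raw) matroid on the universe Fin n, given by its ground set E ⊆ Fin n
-- and its rank function r.  Only the values of r on subsets of E matter.
record RawMatroid (n : ℕ) : Set where
  constructor mkMatroid
  field
    E : Subset n
    r : Subset n → ℕ
open RawMatroid public

record IsMatroid {n : ℕ} (M : RawMatroid n) : Set where
  field
    R1 : ∀ X → X ⊆ E M → r M X ≤ ∣ X ∣
    R2 : ∀ X Y → X ⊆ Y → Y ⊆ E M → r M X ≤ r M Y
    R3 : ∀ X Y → X ⊆ E M → Y ⊆ E M →
         r M (X ∪ Y) + r M (X ∩ Y) ≤ r M X + r M Y

_＼_ : ∀ {n} → RawMatroid n → Subset n → RawMatroid n
M ＼ D = mkMatroid (E M ─ D) (r M)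

_／_ : ∀ {n} → RawMatroid n → Subset n → RawMatroid n
M ／ C = mkMatroid (E M ─ C) (λ X → r M (X ∪ C) ∸ r M C)

_＼ₑ_ : ∀ {n} → RawMatroid n → Fin n → RawMatroid n
M ＼ₑ a = M ＼ ⁅ a ⁆

_／ₑ_ : ∀ {n} → RawMatroid n → Fin n → RawMatroid n
M ／ₑ a = M ／ ⁅ a ⁆

infixl 6 _＼_ _／_ _＼ₑ_ _／ₑ_

preimage : ∀ {n m} → (Fin n → Fin m) → Subset m → Subset n
preimage φ Y = tabulate (λ x → lookup Y (φ x))

record Iso {n m : ℕ} (M : RawMatroid n) (N : RawMatroid m) : Set where
  field
    φ       : Fin n → Fin m
    maps    : ∀ x → x ∈ E M → φ x ∈ E N
    inj     : ∀ x y → x ∈ E M → y ∈ E M → φ x ≡ φ y → x ≡ y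
    surj    : ∀ y → y ∈ E N → ∃[ x ] (x ∈ E M × φ x ≡ y)
    rank    : ∀ Y → Y ⊆ E N → r N Y ≡ r M (preimage φ Y ∩ E M)

HasMinor : ∀ {n m} → RawMatroid n → RawMatroid m → Set
HasMinor M N = ∃[ C ] ∃[ D ] (C ⊆ E M × D ⊆ E M × Empty (C ∩ D) × Iso (M ／ C ＼ D) N)

Independent : ∀ {n} → RawMatroid n → Subset n → Set
Independent M X = X ⊆ E M × r M X ≡ ∣ X ∣

Circuit : ∀ {n} → RawMatroid n → Subset n → Set
Circuit M C = C ⊆ E M × ¬ Independent M C × (∀ Y → Y ⊂ C → Independent M Y)

Triangle : ∀ {n} → RawMatroid n → Subset n → Set
Triangle M T = Circuit M T × ∣ T ∣ ≡ 3

Separation : ∀ {n} → RawMatroid n → ℕ → Subset n → Set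
Separation M k X =
  X ⊆ E M × k ≤ ∣ X ∣ × k ≤ ∣ E M ─ X ∣ × r M X + r M (E M ─ X) < r M (E M) + k

Connected : ∀ {n} → ℕ → RawMatroid n → Set
Connected k M = ∀ j → 1 ≤ j → j < k → ∀ X → ¬ Separation M j X

ThreeConnected : ∀ {n} → RawMatroid n → Set
ThreeConnected M = Connected 3 M

Grounded : ∀ {n m} → RawMatroid n → RawMatroid m → Subset n → Set
Grounded M N T = ∀ a b → a ∈ T → b ∈ T → a ≢ b →
  ¬ HasMinor (M ／ₑ a ／ₑ b) N × ¬ HasMinor (M ／ₑ a ＼ₑ b) N ×
  ¬ HasMinor (M ＼ₑ a ／ₑ b) N × ¬ HasMinor (M ＼ₑ a ＼ₑ b) N

-- Let T = {x, y, z} and suppose M / x has an N-minor M / x / C \ D.  If y or z lay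
-- in C or D, then one of M / x / y, M / x \ y, M / x / z, M / x \ z would have an
-- N-minor, contradicting groundedness.  So y and z survive in the minor; but
-- contracting x makes them parallel (submodularity applied to T and C ∪ {x}), and
-- a parallel pair is a 2-separation of N, since |E(N)| ≥ 4.
module Submission where

open import Defs
open import Data.Nat using (ℕ; _≤_)
open import Data.Fin using (Fin)
open import Data.Fin.Subset using (Subset; _∈_; ∣_∣)
open import Relation.Nullary using (¬_)

open import Data.Nat using (suc; _+_; _∸_; _<_; z≤n; s≤s)
open import Data.Nat.Properties
open import Data.Vec.Base using (_∷_; []; here; there; lookup)
open import Data.Vec.Properties using (lookup∘tabulate; []=⇒lookup; lookup⇒[]=)
open import Data.Fin.Subset
  using (_∉_; _⊆_; _⊂_; _∩_; _∪_; _─_; _-_; ⁅_⁆; Empty; Nonempty; inside; outside)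
open import Data.Fin.Subset.Properties
  using (_∈?_; nonempty?; Empty-unique; ∣⊥∣≡0; ⊆-reflexive; ⊆-antisym; ⊆-trans; ∪-assoc; ∪-comm;
         x∈⁅x⁆; x∈⁅y⁆⇒x≡y; x≢y⇒x∉⁅y⁆; x∉⁅y⁆⇒x≢y; ∣⁅x⁆∣≡1; p⊆q⇒∣p∣≤∣q∣; p⊂q⇒∣p∣<∣q∣;
         p∩q⊆p; p∩q⊆q; x∈p∩q⁺; x∈p∪q⁻; p⊆p∪q; q⊆p∪q;
         x∈p∧x∉q⇒x∈p─q; x∈p∧x≢y⇒x∈p-y; p─q⊆p; p─q─r≡p─q∪r; p─q─r≡p─r─q)
open import Data.Product using (∃-syntax; _×_; _,_; proj₁; proj₂)
open import Data.Sum using (inj₁; inj₂)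
open import Relation.Nullary using (yes; no; contradiction)
open import Relation.Binary.PropositionalEquality
open import Function using (_∘_)

private
  variable
    n m : ℕ
    x y : Fin n
    p q s : Subset n
    B C D T W : Subset n
    M A : RawMatroid n
    N : RawMatroid m

x∈p─q⁻ : ∀ (p q : Subset n) → x ∈ p ─ q → x ∈ p × x ∉ q
x∈p─q⁻ p q x∈p─q = p─q⊆p p q x∈p─q , x∉q p q x∈p─q
  where
  x∉q : ∀ {n} {x : Fin n} (p q : Subset n) → x ∈ p ─ q → x ∉ q
  x∉q (_ ∷ p) (inside ∷ q) () here
  x∉q (_ ∷ p) (_ ∷ q) (there x∈p─q) (there x∈q) = x∉q p q x∈p─q x∈q

∪-⊆ : p ⊆ s → q ⊆ s → p ∪ q ⊆ s
∪-⊆ {p = p} {q = q} p⊆s q⊆s x∈p∪q with x∈p∪q⁻ p q x∈p∪q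
... | inj₁ x∈p = p⊆s x∈p
... | inj₂ x∈q = q⊆s x∈q

x∈p⇒⁅x⁆⊆p : x ∈ p → ⁅ x ⁆ ⊆ p
x∈p⇒⁅x⁆⊆p {x = x} x∈p y∈⁅x⁆ rewrite x∈⁅y⁆⇒x≡y x y∈⁅x⁆ = x∈p

─-monoˡ-⊆ : p ⊆ q → p ─ s ⊆ q ─ s
─-monoˡ-⊆ {p = p} {s = s} p⊆q x∈p─s =
  let x∈p , x∉s = x∈p─q⁻ p s x∈p─s in x∈p∧x∉q⇒x∈p─q (p⊆q x∈p) x∉s

p⊆q∧x∉p⇒p⊆q-x : p ⊆ q → x ∉ p → p ⊆ q - x
p⊆q∧x∉p⇒p⊆q-x {p = p} p⊆q x∉p w∈p =
  x∈p∧x∉q⇒x∈p─q (p⊆q w∈p) (λ w∈⁅x⁆ → x∉p (subst (_∈ p) (x∈⁅y⁆⇒x≡y _ w∈⁅x⁆) w∈p))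

p⊆[p─q]∪q : ∀ (p q : Subset n) → p ⊆ (p ─ q) ∪ q
p⊆[p─q]∪q p q {x} x∈p with x ∈? q
... | yes x∈q = q⊆p∪q _ q x∈q
... | no x∉q = p⊆p∪q q (x∈p∧x∉q⇒x∈p─q x∈p x∉q)

x∈p⇒⁅x⁆∪[p-x]≡p : x ∈ p → ⁅ x ⁆ ∪ (p - x) ≡ p
x∈p⇒⁅x⁆∪[p-x]≡p {x = x} {p = p} x∈p = ⊆-antisym
  (∪-⊆ (x∈p⇒⁅x⁆⊆p x∈p) (p─q⊆p p ⁅ x ⁆))
  (⊆-trans (p⊆[p─q]∪q p ⁅ x ⁆) (⊆-reflexive (∪-comm (p - x) ⁅ x ⁆)))

[p-x]∪⁅x⁆≡p : x ∈ p → (p - x) ∪ ⁅ x ⁆ ≡ p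
[p-x]∪⁅x⁆≡p {x = x} {p = p} x∈p = trans (∪-comm (p - x) ⁅ x ⁆) (x∈p⇒⁅x⁆∪[p-x]≡p x∈p)

∈-preimage⁻ : ∀ (φ : Fin n → Fin m) Y {w} → w ∈ preimage φ Y → φ w ∈ Y
∈-preimage⁻ φ Y {w} w∈φ⁻¹Y = lookup⇒[]= (φ w) Y
  (trans (sym (lookup∘tabulate (λ i → lookup Y (φ i)) w)) ([]=⇒lookup w∈φ⁻¹Y))

∣p∪q∣≤∣p∣+∣q∣ : ∀ (p q : Subset n) → ∣ p ∪ q ∣ ≤ ∣ p ∣ + ∣ q ∣
∣p∪q∣≤∣p∣+∣q∣ [] [] = z≤n
∣p∪q∣≤∣p∣+∣q∣ (outside ∷ p) (outside ∷ q) = ∣p∪q∣≤∣p∣+∣q∣ p q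
∣p∪q∣≤∣p∣+∣q∣ (outside ∷ p) (inside ∷ q) =
  ≤-trans (s≤s (∣p∪q∣≤∣p∣+∣q∣ p q)) (≤-reflexive (sym (+-suc ∣ p ∣ ∣ q ∣)))
∣p∪q∣≤∣p∣+∣q∣ (inside ∷ p) (outside ∷ q) = s≤s (∣p∪q∣≤∣p∣+∣q∣ p q)
∣p∪q∣≤∣p∣+∣q∣ (inside ∷ p) (inside ∷ q) =
  s≤s (≤-trans (∣p∪q∣≤∣p∣+∣q∣ p q) (+-monoʳ-≤ ∣ p ∣ (n≤1+n ∣ q ∣)))

∣p∣≤∣p─q∣+∣q∣ : ∀ (p q : Subset n) → ∣ p ∣ ≤ ∣ p ─ q ∣ + ∣ q ∣
∣p∣≤∣p─q∣+∣q∣ p q = ≤-trans (p⊆q⇒∣p∣≤∣q∣ (p⊆[p─q]∪q p q)) (∣p∪q∣≤∣p∣+∣q∣ (p ─ q) q)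

∣⁅x⁆∪⁅y⁆∣≡2 : x ≢ y → ∣ ⁅ x ⁆ ∪ ⁅ y ⁆ ∣ ≡ 2
∣⁅x⁆∪⁅y⁆∣≡2 {x = x} {y = y} x≢y = ≤-antisym upper lower
  where
  upper : ∣ ⁅ x ⁆ ∪ ⁅ y ⁆ ∣ ≤ 2
  upper = subst₂ (λ i j → ∣ ⁅ x ⁆ ∪ ⁅ y ⁆ ∣ ≤ i + j) (∣⁅x⁆∣≡1 x) (∣⁅x⁆∣≡1 y)
            (∣p∪q∣≤∣p∣+∣q∣ ⁅ x ⁆ ⁅ y ⁆)
  ⁅x⁆⊂⁅x⁆∪⁅y⁆ : ⁅ x ⁆ ⊂ ⁅ x ⁆ ∪ ⁅ y ⁆
  ⁅x⁆⊂⁅x⁆∪⁅y⁆ = p⊆p∪q ⁅ y ⁆ , y , q⊆p∪q ⁅ x ⁆ ⁅ y ⁆ (x∈⁅x⁆ y) , x≢y⇒x∉⁅y⁆ (x≢y ∘ sym)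
  lower : 2 ≤ ∣ ⁅ x ⁆ ∪ ⁅ y ⁆ ∣
  lower = subst (λ k → suc k ≤ ∣ ⁅ x ⁆ ∪ ⁅ y ⁆ ∣) (∣⁅x⁆∣≡1 x) (p⊂q⇒∣p∣<∣q∣ ⁅x⁆⊂⁅x⁆∪⁅y⁆)

∣p∣≤1+∣p-x∣ : ∀ (p : Subset n) x → ∣ p ∣ ≤ suc ∣ p - x ∣
∣p∣≤1+∣p-x∣ p x = subst (∣ p ∣ ≤_)
  (trans (cong (∣ p - x ∣ +_) (∣⁅x⁆∣≡1 x)) (+-comm ∣ p - x ∣ 1)) (∣p∣≤∣p─q∣+∣q∣ p ⁅ x ⁆)

1+k≤∣p∣⇒k≤∣p-x∣ : ∀ {k} → suc k ≤ ∣ p ∣ → k ≤ ∣ p - x ∣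
1+k≤∣p∣⇒k≤∣p-x∣ {p = p} {x = x} 1+k≤∣p∣ = ≤-pred (≤-trans 1+k≤∣p∣ (∣p∣≤1+∣p-x∣ p x))

0<∣p∣⇒Nonempty : ∀ {n} {p : Subset n} → 0 < ∣ p ∣ → Nonempty p
0<∣p∣⇒Nonempty {n} {p} 0<∣p∣ with nonempty? p
... | yes ne = ne
... | no empty =
  contradiction (trans (cong ∣_∣ (Empty-unique {p = p} empty)) (∣⊥∣≡0 n)) (≢-sym (<⇒≢ 0<∣p∣))

∣p∣≡3⇒two-others : ∣ p ∣ ≡ 3 → x ∈ p →
  ∃[ y ] ∃[ z ] (y ∈ p × z ∈ p × x ≢ y × x ≢ z × y ≢ z)
∣p∣≡3⇒two-others {p = p} {x = x} ∣p∣≡3 x∈p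
  with 2≤∣p-x∣ ← 1+k≤∣p∣⇒k≤∣p-x∣ {p = p} {x = x} (≤-reflexive (sym ∣p∣≡3))
  with y , y∈p-x ← 0<∣p∣⇒Nonempty {p = p - x} (≤-trans (s≤s z≤n) 2≤∣p-x∣)
  with z , z∈p-x-y ←
       0<∣p∣⇒Nonempty {p = p - x - y} (1+k≤∣p∣⇒k≤∣p-x∣ {p = p - x} {x = y} 2≤∣p-x∣)
  = y , z , y∈p , z∈p , x≢y , x≢z , y≢z
  where
  y∈p : y ∈ p
  y∈p = proj₁ (x∈p─q⁻ p ⁅ x ⁆ y∈p-x)
  x≢y : x ≢ y
  x≢y = ≢-sym (x∉⁅y⁆⇒x≢y (proj₂ (x∈p─q⁻ p ⁅ x ⁆ y∈p-x)))
  z∈p-x : z ∈ p - x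
  z∈p-x = proj₁ (x∈p─q⁻ (p - x) ⁅ y ⁆ z∈p-x-y)
  z∈p : z ∈ p
  z∈p = proj₁ (x∈p─q⁻ p ⁅ x ⁆ z∈p-x)
  x≢z : x ≢ z
  x≢z = ≢-sym (x∉⁅y⁆⇒x≢y (proj₂ (x∈p─q⁻ p ⁅ x ⁆ z∈p-x)))
  y≢z : y ≢ z
  y≢z = ≢-sym (x∉⁅y⁆⇒x≢y (proj₂ (x∈p─q⁻ (p - x) ⁅ y ⁆ z∈p-x-y)))

[m∸n]∸[o∸n]≡m∸o : ∀ m {n o} → n ≤ o → (m ∸ n) ∸ (o ∸ n) ≡ m ∸ o
[m∸n]∸[o∸n]≡m∸o m {n} {o} n≤o = trans (∸-+-assoc m n (o ∸ n)) (cong (m ∸_) (m+[n∸m]≡n n≤o))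

RankMonotone : RawMatroid n → Set
RankMonotone M = ∀ X Y → X ⊆ Y → Y ⊆ E M → r M X ≤ r M Y

／-monotone : RankMonotone M → B ⊆ E M → RankMonotone (M ／ B)
／-monotone {M = M} {B = B} mono B⊆E X Y X⊆Y Y⊆E = ∸-monoˡ-≤ (r M B)
  (mono (X ∪ B) (Y ∪ B) (∪-⊆ (λ w∈X → p⊆p∪q B (X⊆Y w∈X)) (q⊆p∪q Y B))
        (∪-⊆ (λ w∈Y → p─q⊆p (E M) B (Y⊆E w∈Y)) B⊆E))

／-／-rank : RankMonotone M → C ∪ B ⊆ E M →
  ∀ X → r (M ／ B ／ C) X ≡ r M ((X ∪ C) ∪ B) ∸ r M (C ∪ B)
／-／-rank {M = M} {C = C} {B = B} mono C∪B⊆E X =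
  [m∸n]∸[o∸n]≡m∸o (r M ((X ∪ C) ∪ B)) (mono B (C ∪ B) (q⊆p∪q C B) C∪B⊆E)

Iso-cong : ∀ {A B : RawMatroid n} → E A ≡ E B → (∀ X → X ⊆ E A → r A X ≡ r B X) →
  Iso A N → Iso B N
Iso-cong {A = mkMatroid _ _} {B = mkMatroid _ _} refl r≡ iso = record
  { φ = φ ; maps = maps ; inj = inj ; surj = surj
  ; rank = λ Y Y⊆E → trans (rank Y Y⊆E) (r≡ _ (p∩q⊆q _ _)) }
  where open Iso iso

MinorIso : RawMatroid n → Subset n → Subset n → RawMatroid m → Set
MinorIso M C D N = C ⊆ E M × D ⊆ E M × Empty (C ∩ D) × Iso (M ／ C ＼ D) N

HasMinor-＼ₑ : MinorIso M C D N → x ∈ D → HasMinor (M ＼ₑ x) N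
HasMinor-＼ₑ {M = M} {C = C} {D = D} {x = x} (C⊆E , D⊆E , C∩D=∅ , iso) x∈D =
  C , D - x , p⊆q∧x∉p⇒p⊆q-x C⊆E x∉C , ─-monoˡ-⊆ D⊆E , C∩[D-x]=∅ , Iso-cong E≡ (λ _ _ → refl) iso
  where
  x∉C : x ∉ C
  x∉C x∈C = C∩D=∅ (x , x∈p∩q⁺ (x∈C , x∈D))
  C∩[D-x]=∅ : Empty (C ∩ (D - x))
  C∩[D-x]=∅ (w , w∈C∩D-x) =
    C∩D=∅ (w , x∈p∩q⁺ (p∩q⊆p C _ w∈C∩D-x , p─q⊆p D ⁅ x ⁆ (p∩q⊆q C _ w∈C∩D-x)))
  E≡ : E M ─ C ─ D ≡ E M - x ─ C ─ (D - x)
  E≡ = begin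
    E M ─ C ─ D                  ≡⟨ cong (E M ─ C ─_) (x∈p⇒⁅x⁆∪[p-x]≡p x∈D) ⟨
    E M ─ C ─ (⁅ x ⁆ ∪ (D - x))  ≡⟨ p─q─r≡p─q∪r (E M ─ C) ⁅ x ⁆ (D - x) ⟨
    E M ─ C - x ─ (D - x)        ≡⟨ cong (_─ (D - x)) (p─q─r≡p─r─q (E M) C ⁅ x ⁆) ⟩
    E M - x ─ C ─ (D - x)        ∎
    where open ≡-Reasoning

HasMinor-／ₑ : RankMonotone M → MinorIso M C D N → x ∈ C → HasMinor (M ／ₑ x) N
HasMinor-／ₑ {M = M} {C = C} {D = D} {x = x} mono (C⊆E , D⊆E , C∩D=∅ , iso) x∈C =
  C - x , D , ─-monoˡ-⊆ C⊆E , p⊆q∧x∉p⇒p⊆q-x D⊆E x∉D , [C-x]∩D=∅ , Iso-cong E≡ r≡ iso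
  where
  x∉D : x ∉ D
  x∉D x∈D = C∩D=∅ (x , x∈p∩q⁺ (x∈C , x∈D))
  [C-x]∩D=∅ : Empty ((C - x) ∩ D)
  [C-x]∩D=∅ (w , w∈C-x∩D) =
    C∩D=∅ (w , x∈p∩q⁺ (p─q⊆p C ⁅ x ⁆ (p∩q⊆p _ D w∈C-x∩D) , p∩q⊆q _ D w∈C-x∩D))
  C≡ : (C - x) ∪ ⁅ x ⁆ ≡ C
  C≡ = [p-x]∪⁅x⁆≡p x∈C
  E≡ : E M ─ C ─ D ≡ E M - x ─ (C - x) ─ D
  E≡ = cong (_─ D) (begin
    E M ─ C                    ≡⟨ cong (E M ─_) (x∈p⇒⁅x⁆∪[p-x]≡p x∈C) ⟨
    E M ─ (⁅ x ⁆ ∪ (C - x))    ≡⟨ p─q─r≡p─q∪r (E M) ⁅ x ⁆ (C - x) ⟨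
    E M - x ─ (C - x)          ∎)
    where open ≡-Reasoning
  r≡ : ∀ X → X ⊆ E M ─ C ─ D → r (M ／ C ＼ D) X ≡ r (M ／ₑ x ／ (C - x) ＼ D) X
  r≡ X _ = sym (begin
    r (M ／ₑ x ／ (C - x)) X
      ≡⟨ ／-／-rank mono (subst (_⊆ E M) (sym C≡) C⊆E) X ⟩
    r M ((X ∪ (C - x)) ∪ ⁅ x ⁆) ∸ r M ((C - x) ∪ ⁅ x ⁆)
      ≡⟨ cong₂ (λ U V → r M U ∸ r M V) (trans (∪-assoc X (C - x) ⁅ x ⁆) (cong (X ∪_) C≡)) C≡ ⟩
    r M (X ∪ C) ∸ r M C
      ∎)
    where open ≡-Reasoning

Circuit⇒r<∣C∣ : IsMatroid M → Circuit M C → r M C < ∣ C ∣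
Circuit⇒r<∣C∣ isM (C⊆E , dependent , _) =
  ≤∧≢⇒< (IsMatroid.R1 isM _ C⊆E) (λ r≡∣C∣ → dependent (C⊆E , r≡∣C∣))

Circuit⇒r⁅x⁆≡1 : Circuit M C → x ∈ C → y ∈ C → x ≢ y → r M ⁅ x ⁆ ≡ 1
Circuit⇒r⁅x⁆≡1 {x = x} {y = y} (_ , _ , proper⇒independent) x∈C y∈C x≢y =
  trans (proj₂ (proper⇒independent ⁅ x ⁆ ⁅x⁆⊂C)) (∣⁅x⁆∣≡1 x)
  where
  ⁅x⁆⊂C : ⁅ x ⁆ ⊂ _
  ⁅x⁆⊂C = x∈p⇒⁅x⁆⊆p x∈C , y , y∈C , x≢y⇒x∉⁅y⁆ (x≢y ∘ sym)

Triangle⇒r[T∪W]≤1+r[W] : IsMatroid M → Triangle M T → x ∈ T → x ∈ W → W ⊆ E M →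
  r M (T ∪ W) ≤ suc (r M W)
Triangle⇒r[T∪W]≤1+r[W] {M = M} {T = T} {x = x} {W = W} isM (circuit , ∣T∣≡3) x∈T x∈W W⊆E
  with y , _ , y∈T , _ , x≢y , _ ← ∣p∣≡3⇒two-others ∣T∣≡3 x∈T =
  +-cancelʳ-≤ 1 _ _ (begin
    r M (T ∪ W) + 1            ≡⟨ cong (r M (T ∪ W) +_) (Circuit⇒r⁅x⁆≡1 circuit x∈T y∈T x≢y) ⟨
    r M (T ∪ W) + r M ⁅ x ⁆    ≤⟨ +-monoʳ-≤ (r M (T ∪ W)) r⁅x⁆≤r[T∩W] ⟩
    r M (T ∪ W) + r M (T ∩ W)  ≤⟨ R3 T W T⊆E W⊆E ⟩
    r M T + r M W              ≤⟨ +-monoˡ-≤ (r M W) rT≤2 ⟩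
    2 + r M W                  ≡⟨ cong suc (+-comm 1 (r M W)) ⟩
    suc (r M W) + 1            ∎)
  where
  open IsMatroid isM
  open ≤-Reasoning
  T⊆E : T ⊆ E M
  T⊆E = proj₁ circuit
  T∩W⊆E : T ∩ W ⊆ E M
  T∩W⊆E w∈T∩W = T⊆E (p∩q⊆p T W w∈T∩W)
  r⁅x⁆≤r[T∩W] : r M ⁅ x ⁆ ≤ r M (T ∩ W)
  r⁅x⁆≤r[T∩W] = R2 ⁅ x ⁆ (T ∩ W) (x∈p⇒⁅x⁆⊆p (x∈p∩q⁺ (x∈T , x∈W))) T∩W⊆E
  rT≤2 : r M T ≤ 2
  rT≤2 = ≤-pred (subst (r M T <_) ∣T∣≡3 (Circuit⇒r<∣C∣ isM circuit))

Triangle⇒r[M／x／C]≤1 : IsMatroid M → Triangle M T → x ∈ T → C ⊆ E M →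
  ∀ P → P ⊆ T → r (M ／ₑ x ／ C) P ≤ 1
Triangle⇒r[M／x／C]≤1 {M = M} {T = T} {x = x} {C = C} isM triangle x∈T C⊆E P P⊆T = begin
  r (M ／ₑ x ／ C) P               ≡⟨ ／-／-rank R2 Cx⊆E P ⟩
  r M ((P ∪ C) ∪ ⁅ x ⁆) ∸ r M Cx  ≤⟨ ∸-monoˡ-≤ (r M Cx) (R2 _ (T ∪ Cx) P∪Cx⊆T∪Cx (∪-⊆ T⊆E Cx⊆E)) ⟩
  r M (T ∪ Cx) ∸ r M Cx           ≤⟨ ∸-monoˡ-≤ (r M Cx) r[T∪Cx]≤1+r[Cx] ⟩
  suc (r M Cx) ∸ r M Cx           ≡⟨ m+n∸n≡m 1 (r M Cx) ⟩
  1                               ∎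
  where
  open IsMatroid isM
  open ≤-Reasoning
  Cx : Subset _
  Cx = C ∪ ⁅ x ⁆
  T⊆E : T ⊆ E M
  T⊆E = proj₁ (proj₁ triangle)
  x∈Cx : x ∈ Cx
  x∈Cx = q⊆p∪q C ⁅ x ⁆ (x∈⁅x⁆ x)
  Cx⊆E : Cx ⊆ E M
  Cx⊆E = ∪-⊆ C⊆E (x∈p⇒⁅x⁆⊆p (T⊆E x∈T))
  r[T∪Cx]≤1+r[Cx] : r M (T ∪ Cx) ≤ suc (r M Cx)
  r[T∪Cx]≤1+r[Cx] = Triangle⇒r[T∪W]≤1+r[W] isM triangle x∈T x∈Cx Cx⊆E
  P∪Cx⊆T∪Cx : (P ∪ C) ∪ ⁅ x ⁆ ⊆ T ∪ Cx
  P∪Cx⊆T∪Cx = ∪-⊆ (∪-⊆ (λ w∈P → p⊆p∪q Cx (P⊆T w∈P)) (λ w∈C → q⊆p∪q T Cx (p⊆p∪q ⁅ x ⁆ w∈C)))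
                (λ w∈⁅x⁆ → q⊆p∪q T Cx (q⊆p∪q C ⁅ x ⁆ w∈⁅x⁆))

Iso-pair-rank : (iso : Iso A N) → x ∈ E A → y ∈ E A →
  (∀ P → P ⊆ ⁅ x ⁆ ∪ ⁅ y ⁆ → r A P ≤ 1) → r N (⁅ Iso.φ iso x ⁆ ∪ ⁅ Iso.φ iso y ⁆) ≤ 1
Iso-pair-rank {A = A} {N = N} {x = x} {y = y} iso x∈A y∈A pair-rank≤1 =
  subst (_≤ 1) (sym (rank Y Y⊆E)) (pair-rank≤1 _ preimage⊆pair)
  where
  open Iso iso
  Y : Subset _
  Y = ⁅ φ x ⁆ ∪ ⁅ φ y ⁆
  Y⊆E : Y ⊆ E N
  Y⊆E = ∪-⊆ (x∈p⇒⁅x⁆⊆p (maps x x∈A)) (x∈p⇒⁅x⁆⊆p (maps y y∈A))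
  φ-reflects-⁅⁆ : ∀ {w v} → w ∈ E A → v ∈ E A → φ w ∈ ⁅ φ v ⁆ → w ∈ ⁅ v ⁆
  φ-reflects-⁅⁆ {w} {v} w∈A v∈A φw∈⁅φv⁆ =
    subst (_∈ ⁅ v ⁆) (sym (inj w v w∈A v∈A (x∈⁅y⁆⇒x≡y _ φw∈⁅φv⁆))) (x∈⁅x⁆ v)
  preimage⊆pair : preimage φ Y ∩ E A ⊆ ⁅ x ⁆ ∪ ⁅ y ⁆
  preimage⊆pair w∈φ⁻¹Y∩A with x∈p∪q⁻ ⁅ φ x ⁆ ⁅ φ y ⁆ (∈-preimage⁻ φ Y (p∩q⊆p _ _ w∈φ⁻¹Y∩A))
  ... | inj₁ φw∈⁅φx⁆ = p⊆p∪q ⁅ y ⁆ (φ-reflects-⁅⁆ (p∩q⊆q _ _ w∈φ⁻¹Y∩A) x∈A φw∈⁅φx⁆)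
  ... | inj₂ φw∈⁅φy⁆ = q⊆p∪q ⁅ x ⁆ ⁅ y ⁆ (φ-reflects-⁅⁆ (p∩q⊆q _ _ w∈φ⁻¹Y∩A) y∈A φw∈⁅φy⁆)

r[⁅x⁆∪⁅y⁆]≤1⇒2-separation : IsMatroid N → 4 ≤ ∣ E N ∣ → x ∈ E N → y ∈ E N → x ≢ y →
  r N (⁅ x ⁆ ∪ ⁅ y ⁆) ≤ 1 → Separation N 2 (⁅ x ⁆ ∪ ⁅ y ⁆)
r[⁅x⁆∪⁅y⁆]≤1⇒2-separation {N = N} {x = x} {y = y} isN 4≤∣E∣ x∈E y∈E x≢y rX≤1 =
  X⊆E , ≤-reflexive (sym ∣X∣≡2) , 2≤∣E─X∣ , rank-sum
  where
  X : Subset _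
  X = ⁅ x ⁆ ∪ ⁅ y ⁆
  X⊆E : X ⊆ E N
  X⊆E = ∪-⊆ (x∈p⇒⁅x⁆⊆p x∈E) (x∈p⇒⁅x⁆⊆p y∈E)
  ∣X∣≡2 : ∣ X ∣ ≡ 2
  ∣X∣≡2 = ∣⁅x⁆∪⁅y⁆∣≡2 x≢y
  2≤∣E─X∣ : 2 ≤ ∣ E N ─ X ∣
  2≤∣E─X∣ = +-cancelʳ-≤ 2 2 _
    (≤-trans 4≤∣E∣ (subst (∣ E N ∣ ≤_) (cong (∣ E N ─ X ∣ +_) ∣X∣≡2) (∣p∣≤∣p─q∣+∣q∣ (E N) X)))
  rank-sum : r N X + r N (E N ─ X) < r N (E N) + 2
  rank-sum = ≤-trans (s≤s (+-mono-≤ rX≤1 (IsMatroid.R2 isN _ _ (p─q⊆p (E N) X) (λ w∈E → w∈E))))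
                     (≤-reflexive (+-comm 2 (r N (E N))))

Grounded⇒survives-minor : IsMatroid M → Grounded M N T → T ⊆ E M → x ∈ T → y ∈ T → x ≢ y →
  MinorIso (M ／ₑ x) C D N → y ∈ E (M ／ₑ x ／ C ＼ D)
Grounded⇒survives-minor {M = M} {T = T} {x = x} {y = y} {C = C} {D = D}
  isM grounded T⊆E x∈T y∈T x≢y minor with y ∈? C | y ∈? D
... | yes y∈C | _ =
  contradiction (HasMinor-／ₑ {M = M ／ₑ x} M／x-monotone minor y∈C) (proj₁ (grounded x y x∈T y∈T x≢y))
  where
  M／x-monotone : RankMonotone (M ／ₑ x)
  M／x-monotone = ／-monotone (IsMatroid.R2 isM) (x∈p⇒⁅x⁆⊆p (T⊆E x∈T))
... | no _ | yes y∈D =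
  contradiction (HasMinor-＼ₑ {M = M ／ₑ x} minor y∈D) (proj₁ (proj₂ (grounded x y x∈T y∈T x≢y)))
... | no y∉C | no y∉D =
  x∈p∧x∉q⇒x∈p─q (x∈p∧x∉q⇒x∈p─q (x∈p∧x≢y⇒x∈p-y (T⊆E y∈T) (x≢y ∘ sym)) y∉C) y∉D

lemma3p1 : ∀ {n m} (M : RawMatroid n) (N : RawMatroid m) →
    IsMatroid M → IsMatroid N → ThreeConnected M → ThreeConnected N →
    HasMinor M N → 4 ≤ ∣ E N ∣ →
    (T : Subset n) → Triangle M T → Grounded M N T →
    (x : Fin n) → x ∈ T → ¬ HasMinor (M ／ₑ x) N
lemma3p1 M N isM isN _ 3-connected _ 4≤∣E∣ T triangle grounded x x∈T
  (C , D , minor@(C⊆E-x , _ , _ , iso))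
  with y , z , y∈T , z∈T , x≢y , x≢z , y≢z ← ∣p∣≡3⇒two-others (proj₂ triangle) x∈T =
  3-connected 2 (s≤s z≤n) (s≤s (s≤s (s≤s z≤n))) _
    (r[⁅x⁆∪⁅y⁆]≤1⇒2-separation isN 4≤∣E∣ (maps y y∈A) (maps z z∈A) (y≢z ∘ inj y z y∈A z∈A) parallel)
  where
  open Iso iso
  T⊆E : T ⊆ E M
  T⊆E = proj₁ (proj₁ triangle)
  C⊆E : C ⊆ E M
  C⊆E w∈C = p─q⊆p (E M) ⁅ x ⁆ (C⊆E-x w∈C)
  y∈A : y ∈ E (M ／ₑ x ／ C ＼ D)
  y∈A = Grounded⇒survives-minor isM grounded T⊆E x∈T y∈T x≢y minor
  z∈A : z ∈ E (M ／ₑ x ／ C ＼ D)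
  z∈A = Grounded⇒survives-minor isM grounded T⊆E x∈T z∈T x≢z minor
  parallel : r N (⁅ φ y ⁆ ∪ ⁅ φ z ⁆) ≤ 1
  parallel = Iso-pair-rank iso y∈A z∈A λ P P⊆⁅y⁆∪⁅z⁆ →
    Triangle⇒r[M／x／C]≤1 isM triangle x∈T C⊆E P
      (⊆-trans P⊆⁅y⁆∪⁅z⁆ (∪-⊆ (x∈p⇒⁅x⁆⊆p y∈T) (x∈p⇒⁅x⁆⊆p z∈T)))
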